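{- For all integers $m,n\ge 3$, the torus graph $C_m \square C_n$ is factorable.
   Context: $C_k$ is the cycle on $k$ vertices and $\square$ is the Cartesian product of graphs. All graphs are finite, simple and undirected. A graph $G$ is factorable if there exist graphs $H,K$ on the vertex set $V(G)$ with $A=BC$, where $A,B,C$ are the adjacency matrices of $G,H,K$ with respect to one common ordering of the vertices. -}

module Defs where

open import Data.Nat using (ℕ; zero; suc; _+_; _*_; _%_; _≥_)
open import Data.Nat.Properties using ()
open import Data.Bool using (Bool; true; false; _∨_; _∧_; if_then_else_)
open import Data.Fin using (Fin; toℕ)
open import Data.Fin.Properties using (_≟_)
open import Data.Product using (_×_; _,_; Σ; ∃-syntax)
open import Relation.Nullary.Decidable using (⌊_⌋)
open import Relation.Binary.PropositionalEquality using (_≡_)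

sumFin : (k : ℕ) → (Fin k → ℕ) → ℕ
sumFin zero    f = 0
sumFin (suc k) f = f Data.Fin.zero + sumFin k (λ i → f (Data.Fin.suc i))

record SimpleGraph (V : Set) : Set where
  field
    adj       : V → V → Bool
    symmetric : ∀ u v → adj u v ≡ adj v u
    loopless  : ∀ v → adj v v ≡ false
open SimpleGraph public

A[_] : {V : Set} → SimpleGraph V → V → V → ℕ
A[ G ] u v = if adj G u v then 1 else 0

-- Vertices of the torus: Fin m × Fin n.  Matrix product of two
-- V×V matrices, summing over all vertices (any common ordering of V
-- gives the same product entries).
TorusV : ℕ → ℕ → Set
TorusV m n = Fin m × Fin n

sumTorus : (m n : ℕ) → (TorusV m n → ℕ) → ℕ
sumTorus m n f = sumFin m (λ i → sumFin n (λ j → f (i , j)))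

-- Cycle C_k on Fin k (k ≥ 1 written as suc k'):
-- i ~ j iff j ≡ i+1 (mod k) or i ≡ j+1 (mod k).  For k ≥ 3 this is the
-- adjacency relation of the cycle C_k.
cycAdj : (k : ℕ) → Fin k → Fin k → Bool
cycAdj zero    () _
cycAdj (suc k) i j = ⌊ Data.Nat._≟_ (toℕ j) (suc (toℕ i) % suc k) ⌋
                   ∨ ⌊ Data.Nat._≟_ (toℕ i) (suc (toℕ j) % suc k) ⌋

torusAdj : (m n : ℕ) → TorusV m n → TorusV m n → Bool
torusAdj m n (a , b) (c , d) =
  (cycAdj m a c ∧ ⌊ b ≟ d ⌋) ∨ (⌊ a ≟ c ⌋ ∧ cycAdj n b d)

torusA : (m n : ℕ) → TorusV m n → TorusV m n → ℕ
torusA m n u v = if torusAdj m n u v then 1 else 0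

FactorableTorusMatrix : (m n : ℕ) → (TorusV m n → TorusV m n → ℕ) → Set
FactorableTorusMatrix m n A =
  Σ (SimpleGraph (TorusV m n)) λ H →
  Σ (SimpleGraph (TorusV m n)) λ K →
  ∀ u v → A u v ≡ sumTorus m n (λ w → A[ H ] u w * A[ K ] w v)

module Submission where

-- C_m □ C_n is the Cayley graph of ℤ_m × ℤ_n with connection set D = {±e₁, ±e₂}.  The product of
-- the adjacency matrices of two Cayley graphs Cay(S) and Cay(T) counts, at (u, v), the pairs
-- (s, t) ∈ S × T with u + s + t = v; so it suffices to write D as a sumset S + T in which every
-- element of D arises exactly once, with S, T symmetric and avoiding 0.  If m is even, take
-- S = {σ} with σ = (m/2, 0) of order 2 and T = D + σ (symmetrically if n is even).  If m = 2p+1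
-- and n = 2q+1, take S = {±(p,q)} and T = {±(p,−q)}: the four sums ±(2p,0), ±(0,2q) are ∓e₁, ∓e₂.

open import Defs
open import Algebra.Properties.CommutativeSemigroup using (interchange)
open import Data.Bool using (Bool; true; false; _∨_; _∧_; if_then_else_)
open import Data.Bool.Solver using (module ∨-∧-Solver)
open import Data.Empty using (⊥)
open import Data.Fin as Fin using (Fin; toℕ; fromℕ<)
open import Data.Fin.Properties using (toℕ-injective; toℕ<n; toℕ-fromℕ<) renaming (_≟_ to _≟ᶠ_)
open import Data.List using (List; []; _∷_; _++_; map; concatMap)
open import Data.List.Membership.Propositional using (_∈_; _∉_)
open import Data.List.Membership.Propositional.Properties using (∈-map⁺; ∈-map⁻)
open import Data.List.Properties using (map-++; map-∘; map-cong; ++-identityʳ)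
open import Data.List.Relation.Unary.All using ([]; _∷_)
open import Data.List.Relation.Unary.All.Properties using (All¬⇒¬Any)
open import Data.List.Relation.Unary.Any using (here; there)
open import Data.List.Relation.Unary.Unique.Propositional using (Unique; []; _∷_)
open import Data.Nat as ℕ using (ℕ; zero; suc; _+_; _*_; _∸_; _%_; _≤_; _<_; _≥_; _<?_; z≤n; s≤s; NonZero)
open import Data.Nat.DivMod
  using (m%n<n; [m+n]%n≡m%n; %-distribˡ-+; m%n%n≡m%n; m<n⇒m%n≡m; m≤n⇒[n∸m]%m≡n%m)
open import Data.Nat.ListAction using (sum)
open import Data.Nat.ListAction.Properties using (sum-++)
open import Data.Nat.Properties
open import Data.Nat.Tactic.RingSolver using (solve-∀)
open import Data.Product using (_×_; _,_; proj₁; proj₂; ∃-syntax)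
open import Data.Product.Properties using (≡-dec)
open import Function using (_∘_)
open import Function.Bundles using (_⇔_; mk⇔)
open import Function.Construct.Composition using (_⇔-∘_)
open import Relation.Binary.Definitions using (DecidableEquality)
open import Relation.Binary.PropositionalEquality
open import Relation.Nullary using (Dec; does; yes; no)
open import Relation.Nullary.Decidable using (⌊_⌋; dec-false; does-⇔; isYes≗does)

-- A[ G ] u v and torusA m n u v are definitionally 𝟙 of the corresponding adjacency bit.
𝟙 : Bool → ℕ
𝟙 b = if b then 1 else 0

𝟙-∧ : ∀ x y → 𝟙 (x ∧ y) ≡ 𝟙 x * 𝟙 y
𝟙-∧ true  y = sym (+-identityʳ (𝟙 y))
𝟙-∧ false y = refl

⌊⌋-⇔ : ∀ {A B : Set} → A ⇔ B → (a? : Dec A) (b? : Dec B) → ⌊ a? ⌋ ≡ does b?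
⌊⌋-⇔ A⇔B a? b? = trans (isYes≗does a?) (does-⇔ A⇔B a? b?)

∨-∧-expand : ∀ x y z w e f →
             ((x ∨ y) ∧ z) ∨ (w ∧ (e ∨ f)) ≡ (x ∧ z) ∨ ((w ∧ e) ∨ ((w ∧ f) ∨ ((y ∧ z) ∨ false)))
∨-∧-expand = ∨-∧-Solver.solve 6 (λ x y z w e f → ((x :+ y) :* z) :+ (w :* (e :+ f))
                                   := (x :* z) :+ ((w :* e) :+ ((w :* f) :+ ((y :* z) :+ con false)))) refl
  where open ∨-∧-Solver using (_:=_; _:+_; _:*_; con)

_≟ₜ_ : ∀ {m n} → DecidableEquality (TorusV m n)
_≟ₜ_ = ≡-dec _≟ᶠ_ _≟ᶠ_

does-≟ₜ : ∀ {m n} (i p : Fin m) (j q : Fin n) →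
          does ((i , j) ≟ₜ (p , q)) ≡ does (i ≟ᶠ p) ∧ does (j ≟ᶠ q)
does-≟ₜ i p j q with i ≟ᶠ p
... | no _ = refl
... | yes refl with j ≟ᶠ q
...   | yes refl = refl
...   | no _     = refl

module Occurrences {A : Set} (_≟_ : DecidableEquality A) where
  open import Data.List.Membership.DecPropositional _≟_ using (_∈?_) public

  δ : A → A → ℕ
  δ x y = 𝟙 (does (x ≟ y))

  occ : A → List A → ℕ
  occ x ys = sum (map (δ x) ys)

  occ-++ : ∀ x ys zs → occ x (ys ++ zs) ≡ occ x ys + occ x zs
  occ-++ x ys zs = trans (cong sum (map-++ (δ x) ys zs)) (sum-++ (map (δ x) ys) _)

  occ-concatMap : ∀ x (f : A → List A) ys → occ x (concatMap f ys) ≡ sum (map (λ y → occ x (f y)) ys)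
  occ-concatMap x f [] = refl
  occ-concatMap x f (y ∷ ys) = trans (occ-++ x (f y) _) (cong (occ x (f y) +_) (occ-concatMap x f ys))

  occ-∉ : ∀ {x ys} → x ∉ ys → occ x ys ≡ 0
  occ-∉ {ys = []} x∉ = refl
  occ-∉ {x} {y ∷ ys} x∉ = cong₂ _+_ (cong 𝟙 (dec-false (x ≟ y) (x∉ ∘ here))) (occ-∉ (x∉ ∘ there))

  𝟙-∈?≡occ : ∀ x {ys} → Unique ys → 𝟙 (does (x ∈? ys)) ≡ occ x ys
  𝟙-∈?≡occ x [] = refl
  𝟙-∈?≡occ x {y ∷ ys} (y∉ys ∷ u) with x ≟ y
  ... | yes refl = cong suc (sym (occ-∉ (All¬⇒¬Any y∉ys)))
  ... | no _ = 𝟙-∈?≡occ x u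

sumFin-cong : ∀ k {f g : Fin k → ℕ} → (∀ i → f i ≡ g i) → sumFin k f ≡ sumFin k g
sumFin-cong zero    f≗g = refl
sumFin-cong (suc k) f≗g = cong₂ _+_ (f≗g Fin.zero) (sumFin-cong k (f≗g ∘ Fin.suc))

sumFin-0 : ∀ k → sumFin k (λ _ → 0) ≡ 0
sumFin-0 zero    = refl
sumFin-0 (suc k) = sumFin-0 k

sumFin-+ : ∀ k (f g : Fin k → ℕ) → sumFin k (λ i → f i + g i) ≡ sumFin k f + sumFin k g
sumFin-+ zero    f g = refl
sumFin-+ (suc k) f g = begin
  f₀ + g₀ + sumFin k (λ i → f (Fin.suc i) + g (Fin.suc i)) ≡⟨ cong (f₀ + g₀ +_) (sumFin-+ k _ _) ⟩
  f₀ + g₀ + (Σf + Σg)                                  ≡⟨ interchange +-commutativeSemigroup f₀ g₀ Σf Σg ⟩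
  f₀ + Σf + (g₀ + Σg)                                  ∎
  where
    open ≡-Reasoning
    f₀ = f Fin.zero
    g₀ = g Fin.zero
    Σf = sumFin k (f ∘ Fin.suc)
    Σg = sumFin k (g ∘ Fin.suc)

sumFin-*ˡ : ∀ k c (f : Fin k → ℕ) → sumFin k (λ i → c * f i) ≡ c * sumFin k f
sumFin-*ˡ zero    c f = sym (*-zeroʳ c)
sumFin-*ˡ (suc k) c f = trans (cong (c * f Fin.zero +_) (sumFin-*ˡ k c (f ∘ Fin.suc))) (sym (*-distribˡ-+ c _ _))

module FinOcc {k : ℕ} = Occurrences (_≟ᶠ_ {k})

sumFin-δ : ∀ k (p : Fin k) (f : Fin k → ℕ) → sumFin k (λ i → FinOcc.δ i p * f i) ≡ f p
sumFin-δ (suc k) Fin.zero    f = trans (cong₂ _+_ (+-identityʳ (f Fin.zero)) (sumFin-0 k)) (+-identityʳ _)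
sumFin-δ (suc k) (Fin.suc p) f = sumFin-δ k p (f ∘ Fin.suc)

module TorusOcc {m n : ℕ} = Occurrences (_≟ₜ_ {m} {n})
open TorusOcc using (δ; occ)

δ-pair : ∀ {m n} (i p : Fin m) (j q : Fin n) → δ (i , j) (p , q) ≡ FinOcc.δ i p * FinOcc.δ j q
δ-pair i p j q = trans (cong 𝟙 (does-≟ₜ i p j q)) (𝟙-∧ (does (i ≟ᶠ p)) (does (j ≟ᶠ q)))

sumTorus-cong : ∀ m n {f g : TorusV m n → ℕ} → (∀ u → f u ≡ g u) → sumTorus m n f ≡ sumTorus m n g
sumTorus-cong m n f≗g = sumFin-cong m (λ i → sumFin-cong n (λ j → f≗g (i , j)))

sumTorus-+ : ∀ m n (f g : TorusV m n → ℕ) → sumTorus m n (λ u → f u + g u) ≡ sumTorus m n f + sumTorus m n g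
sumTorus-+ m n f g = trans (sumFin-cong m (λ i → sumFin-+ n _ _)) (sumFin-+ m _ _)

sumTorus-δ : ∀ m n (p : TorusV m n) (f : TorusV m n → ℕ) → sumTorus m n (λ u → δ u p * f u) ≡ f p
sumTorus-δ m n (p , q) f = begin
  sumFin m (λ i → sumFin n (λ j → δ (i , j) (p , q) * f (i , j)))
    ≡⟨ sumFin-cong m (λ i → sumFin-cong n (λ j →
         trans (cong (_* f (i , j)) (δ-pair i p j q)) (*-assoc (FinOcc.δ i p) _ _))) ⟩
  sumFin m (λ i → sumFin n (λ j → FinOcc.δ i p * (FinOcc.δ j q * f (i , j))))
    ≡⟨ sumFin-cong m (λ i →
         trans (sumFin-*ˡ n (FinOcc.δ i p) _) (cong (FinOcc.δ i p *_) (sumFin-δ n q (λ j → f (i , j))))) ⟩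
  sumFin m (λ i → FinOcc.δ i p * f (i , q))
    ≡⟨ sumFin-δ m p (λ i → f (i , q)) ⟩
  f (p , q) ∎
  where open ≡-Reasoning

sumTorus-occ : ∀ m n (xs : List (TorusV m n)) (f : TorusV m n → ℕ) →
               sumTorus m n (λ u → occ u xs * f u) ≡ sum (map f xs)
sumTorus-occ m n [] f = trans (sumFin-cong m (λ _ → sumFin-0 n)) (sumFin-0 m)
sumTorus-occ m n (x ∷ xs) f = begin
  sumTorus m n (λ u → (δ u x + occ u xs) * f u)
    ≡⟨ sumTorus-cong m n (λ u → *-distribʳ-+ (f u) (δ u x) _) ⟩
  sumTorus m n (λ u → δ u x * f u + occ u xs * f u)
    ≡⟨ sumTorus-+ m n _ _ ⟩
  sumTorus m n (λ u → δ u x * f u) + sumTorus m n (λ u → occ u xs * f u)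
    ≡⟨ cong₂ _+_ (sumTorus-δ m n x f) (sumTorus-occ m n xs f) ⟩
  f x + sum (map f xs) ∎
  where open ≡-Reasoning

[m+n%d]%d≡[m+n]%d : ∀ m n d .{{_ : NonZero d}} → (m + n % d) % d ≡ (m + n) % d
[m+n%d]%d≡[m+n]%d m n d = begin
  (m + n % d) % d           ≡⟨ %-distribˡ-+ m (n % d) d ⟩
  (m % d + n % d % d) % d   ≡⟨ cong (λ x → (m % d + x) % d) (m%n%n≡m%n n d) ⟩
  (m % d + n % d) % d       ≡⟨ %-distribˡ-+ m n d ⟨
  (m + n) % d               ∎
  where open ≡-Reasoning

[m+d]%n≢m : ∀ {m d n} .{{_ : NonZero n}} → m < n → 0 < d → d < n → (m + d) % n ≢ m
[m+d]%n≢m {m} {d} {n} m<n 0<d d<n eq with m + d <? n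
... | yes m+d<n = <⇒≢ (m<m+n m 0<d) (sym (trans (sym (m<n⇒m%n≡m m+d<n)) eq))
... | no  m+d≮n = <⇒≢ d<n (+-cancelˡ-≡ m d n (begin
  m + d           ≡⟨ m∸n+n≡m n≤m+d ⟨
  m + d ∸ n + n   ≡⟨ cong (_+ n) m+d∸n≡m ⟩
  m + n           ∎))
  where
    open ≡-Reasoning
    n≤m+d = ≮⇒≥ m+d≮n
    m+d∸n≡m : m + d ∸ n ≡ m
    m+d∸n≡m = begin
      m + d ∸ n           ≡⟨ m<n⇒m%n≡m (m<n+o⇒m∸n<o (m + d) n (+-mono-< m<n d<n)) ⟨
      (m + d ∸ n) % n     ≡⟨ m≤n⇒[n∸m]%m≡n%m n≤m+d ⟩
      (m + d) % n         ≡⟨ eq ⟩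
      m                   ∎

m≡n⇒m≡1*n+0 : ∀ {m n} → m ≡ n → m ≡ 1 * n + 0
m≡n⇒m≡1*n+0 {m} {n} m≡n = trans m≡n (sym (trans (+-identityʳ (1 * n)) (*-identityˡ n)))

[1+n]+[1+n]≡1*[1+[n+n]]+1 : ∀ n → suc n + suc n ≡ 1 * suc (n + n) + 1
[1+n]+[1+n]≡1*[1+[n+n]]+1 = solve-∀

n+[1+n]+[1+n]≡1*[1+[n+[1+n]]]+n : ∀ n → n + suc n + suc n ≡ 1 * suc (n + suc n) + n
n+[1+n]+[1+n]≡1*[1+[n+[1+n]]]+n = solve-∀

module Cycle (k : ℕ) where

  next : Fin (suc k) → Fin (suc k)
  next i = fromℕ< (m%n<n (suc (toℕ i)) (suc k))

  rot : ℕ → Fin (suc k) → Fin (suc k)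
  rot zero    i = i
  rot (suc r) i = next (rot r i)

  rot-+ : ∀ r s i → rot (r + s) i ≡ rot r (rot s i)
  rot-+ zero    s i = refl
  rot-+ (suc r) s i = cong next (rot-+ r s i)

  rot-comm : ∀ r s i → rot r (rot s i) ≡ rot s (rot r i)
  rot-comm r s i = trans (sym (rot-+ r s i)) (trans (cong (λ t → rot t i) (+-comm r s)) (rot-+ s r i))

  toℕ-rot : ∀ r i → toℕ (rot r i) ≡ (toℕ i + r) % suc k
  toℕ-rot zero    i = trans (sym (m<n⇒m%n≡m (toℕ<n i))) (cong (_% suc k) (sym (+-identityʳ (toℕ i))))
  toℕ-rot (suc r) i = begin
    toℕ (next (rot r i))                 ≡⟨ toℕ-fromℕ< _ ⟩
    suc (toℕ (rot r i)) % suc k          ≡⟨ cong (λ x → suc x % suc k) (toℕ-rot r i) ⟩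
    (1 + (toℕ i + r) % suc k) % suc k    ≡⟨ [m+n%d]%d≡[m+n]%d 1 (toℕ i + r) (suc k) ⟩
    suc (toℕ i + r) % suc k              ≡⟨ cong (_% suc k) (+-suc (toℕ i) r) ⟨
    (toℕ i + suc r) % suc k              ∎
    where open ≡-Reasoning

  rot-period : ∀ i → rot (suc k) i ≡ i
  rot-period i = toℕ-injective (begin
    toℕ (rot (suc k) i)        ≡⟨ toℕ-rot (suc k) i ⟩
    (toℕ i + suc k) % suc k    ≡⟨ [m+n]%n≡m%n (toℕ i) (suc k) ⟩
    toℕ i % suc k              ≡⟨ m<n⇒m%n≡m (toℕ<n i) ⟩
    toℕ i                      ∎)
    where open ≡-Reasoning

  rot-periodic : ∀ x r i → rot (x * suc k + r) i ≡ rot r i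
  rot-periodic zero    r i = refl
  rot-periodic (suc x) r i = begin
    rot (suc k + x * suc k + r) i      ≡⟨ cong (λ t → rot t i) (+-assoc (suc k) (x * suc k) r) ⟩
    rot (suc k + (x * suc k + r)) i    ≡⟨ rot-+ (suc k) (x * suc k + r) i ⟩
    rot (suc k) (rot (x * suc k + r) i) ≡⟨ rot-period _ ⟩
    rot (x * suc k + r) i              ≡⟨ rot-periodic x r i ⟩
    rot r i                            ∎
    where open ≡-Reasoning

  rot-k-next : ∀ i → rot k (next i) ≡ i
  rot-k-next i = trans (rot-comm k 1 i) (rot-period i)

  rot-distinct : ∀ {r s} i → r < s → s < suc k → rot s i ≢ rot r i
  rot-distinct {r} {s} i r<s s<k eq =
    [m+d]%n≢m (toℕ<n (rot r i)) (m<n⇒0<n∸m r<s) (≤-<-trans (m∸n≤m s r) s<k) (begin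
    (toℕ (rot r i) + (s ∸ r)) % suc k   ≡⟨ toℕ-rot (s ∸ r) (rot r i) ⟨
    toℕ (rot (s ∸ r) (rot r i))         ≡⟨ cong toℕ (rot-+ (s ∸ r) r i) ⟨
    toℕ (rot (s ∸ r + r) i)             ≡⟨ cong (λ t → toℕ (rot t i)) (m∸n+n≡m (<⇒≤ r<s)) ⟩
    toℕ (rot s i)                       ≡⟨ cong toℕ eq ⟩
    toℕ (rot r i)                       ∎)
    where open ≡-Reasoning

  toℕ≡⇔≡next : ∀ i j → (toℕ j ≡ suc (toℕ i) % suc k) ⇔ (j ≡ next i)
  toℕ≡⇔≡next i j = mk⇔ (λ eq → toℕ-injective (trans eq (sym (toℕ-fromℕ< _))))
                       (λ eq → trans (cong toℕ eq) (toℕ-fromℕ< _))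

  ≡next⇔≡rot-k : ∀ i j → (i ≡ next j) ⇔ (j ≡ rot k i)
  ≡next⇔≡rot-k i j = mk⇔ (λ i≡next-j → sym (trans (cong (rot k) i≡next-j) (rot-k-next j)))
                         (λ j≡rot-k-i → trans (sym (rot-period i)) (cong next (sym j≡rot-k-i)))

  cycAdj-rot : ∀ i j → cycAdj (suc k) i j ≡ does (j ≟ᶠ rot 1 i) ∨ does (j ≟ᶠ rot k i)
  cycAdj-rot i j = cong₂ _∨_
    (⌊⌋-⇔ (toℕ≡⇔≡next i j) (toℕ j ℕ.≟ suc (toℕ i) % suc k) (j ≟ᶠ rot 1 i))
    (⌊⌋-⇔ (≡next⇔≡rot-k i j ⇔-∘ toℕ≡⇔≡next j i)
          (toℕ i ℕ.≟ suc (toℕ j) % suc k) (j ≟ᶠ rot k i))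

module Torus (a b : ℕ) where
  module A = Cycle a
  module B = Cycle b

  V : Set
  V = TorusV (suc a) (suc b)

  open TorusOcc using (_∈?_; 𝟙-∈?≡occ; occ-concatMap)

  ≢-fst : ∀ {u v : V} → proj₁ u ≢ proj₁ v → u ≢ v
  ≢-fst ne eq = ne (cong proj₁ eq)

  ≢-snd : ∀ {u v : V} → proj₂ u ≢ proj₂ v → u ≢ v
  ≢-snd ne eq = ne (cong proj₂ eq)

  -- (r , s) acts by (i , j) ↦ (i + r , j + s); negative shifts are written by their
  -- representatives, e.g. (a , 0) is −e₁ since a ≡ −1 (mod a + 1).
  Shift : Set
  Shift = ℕ × ℕ

  _⊕_ : Shift → Shift → Shift
  (r , s) ⊕ (r' , s') = r + r' , s + s'

  shift : Shift → V → V
  shift (r , s) (i , j) = A.rot r i , B.rot s j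

  _·_ : List Shift → V → List V
  S · u = map (λ s → shift s u) S

  shift-⊕ : ∀ d e u → shift (d ⊕ e) u ≡ shift d (shift e u)
  shift-⊕ (r , s) (r' , s') (i , j) = cong₂ _,_ (A.rot-+ r r' i) (B.rot-+ s s' j)

  shift-comm : ∀ d e u → shift d (shift e u) ≡ shift e (shift d u)
  shift-comm (r , s) (r' , s') (i , j) = cong₂ _,_ (A.rot-comm r r' i) (B.rot-comm s s' j)

  shift-shift : ∀ (d e f : Shift) x y →
                proj₁ (d ⊕ e) ≡ x * suc a + proj₁ f → proj₂ (d ⊕ e) ≡ y * suc b + proj₂ f →
                ∀ u → shift d (shift e u) ≡ shift f u
  shift-shift d e f@(r , s) x y eq eq' u@(i , j) = begin
    shift d (shift e u)                ≡⟨ shift-⊕ d e u ⟨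
    shift (d ⊕ e) u                    ≡⟨ cong₂ (λ r s → shift (r , s) u) eq eq' ⟩
    shift (x * suc a + r , y * suc b + s) u ≡⟨ cong₂ _,_ (A.rot-periodic x r i) (B.rot-periodic y s j) ⟩
    shift f u                          ∎
    where open ≡-Reasoning

  record ConnectionSet (S : List Shift) : Set where
    field
      inverse-closed    : ∀ {s} → s ∈ S → ∃[ t ] t ∈ S × (∀ u → shift t (shift s u) ≡ u)
      fixed-point-free  : ∀ {s} → s ∈ S → ∀ u → shift s u ≢ u
      neighbours-unique : ∀ u → Unique (S · u)

  module _ {S : List Shift} (C : ConnectionSet S) where
    open ConnectionSet C

    neighbour-sym : ∀ {u v} → v ∈ S · u → u ∈ S · v
    neighbour-sym {u} v∈Su with ∈-map⁻ (λ s → shift s u) v∈Su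
    ... | s , s∈S , refl with inverse-closed s∈S
    ...   | t , t∈S , t∘s≗id =
      subst (_∈ S · shift s u) (t∘s≗id u) (∈-map⁺ (λ t → shift t (shift s u)) t∈S)

    cayley : SimpleGraph V
    cayley = record
      { adj       = λ u v → does (v ∈? S · u)
      ; symmetric = λ u v → does-⇔ (mk⇔ neighbour-sym neighbour-sym) (v ∈? S · u) (u ∈? S · v)
      ; loopless  = λ u → dec-false (u ∈? S · u) (λ u∈Su → no-loop (∈-map⁻ (λ s → shift s u) u∈Su))
      }
      where
        no-loop : ∀ {u} → ∃[ s ] s ∈ S × u ≡ shift s u → ⊥
        no-loop (s , s∈S , eq) = fixed-point-free s∈S _ (sym eq)

    A-cayley : ∀ u v → A[ cayley ] u v ≡ occ v (S · u)
    A-cayley u v = 𝟙-∈?≡occ v (neighbours-unique u)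

  cayley-product : ∀ {S T} (CS : ConnectionSet S) (CT : ConnectionSet T) u v →
                   sumTorus (suc a) (suc b) (λ w → A[ cayley CS ] u w * A[ cayley CT ] w v)
                   ≡ occ v (concatMap (T ·_) (S · u))
  cayley-product {S} {T} CS CT u v = begin
    sumTorus (suc a) (suc b) (λ w → A[ cayley CS ] u w * A[ cayley CT ] w v)
      ≡⟨ sumTorus-cong (suc a) (suc b) (λ w → cong₂ _*_ (A-cayley CS u w) (A-cayley CT w v)) ⟩
    sumTorus (suc a) (suc b) (λ w → occ w (S · u) * occ v (T · w))
      ≡⟨ sumTorus-occ (suc a) (suc b) (S · u) (λ w → occ v (T · w)) ⟩
    sum (map (λ w → occ v (T · w)) (S · u))
      ≡⟨ occ-concatMap v (T ·_) (S · u) ⟨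
    occ v (concatMap (T ·_) (S · u)) ∎
    where open ≡-Reasoning

  inverse-pair : ∀ {r r' s s'} → 0 < r → r < r' → r + r' ≡ suc a → s + s' ≡ suc b →
                 ConnectionSet ((r' , s') ∷ (r , s) ∷ [])
  inverse-pair {r} {r'} {s} {s'} 0<r r<r' r+r'≡M s+s'≡N = record
    { inverse-closed    = λ { (here refl)         → (r , s) , there (here refl) , undo
                            ; (there (here refl)) → (r' , s') , here refl ,
                                                    λ u → trans (shift-comm (r' , s') (r , s) u) (undo u) }
    ; fixed-point-free  = λ { (here refl)         (i , j) → ≢-fst (A.rot-distinct i (<-trans 0<r r<r') r'<M)
                            ; (there (here refl)) (i , j) → ≢-fst (A.rot-distinct i 0<r (<-trans r<r' r'<M)) }
    ; neighbours-unique = λ { (i , j) → (≢-fst (A.rot-distinct i r<r' r'<M) ∷ []) ∷ [] ∷ [] }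
    }
    where
      r'<M : r' < suc a
      r'<M = subst (r' <_) r+r'≡M (m<n+m r' 0<r)
      undo : ∀ u → shift (r , s) (shift (r' , s') u) ≡ u
      undo = shift-shift (r , s) (r' , s') (0 , 0) 1 1 (m≡n⇒m≡1*n+0 r+r'≡M) (m≡n⇒m≡1*n+0 s+s'≡N)

  singleton-involution : ∀ σ → (∀ u → shift σ (shift σ u) ≡ u) → (∀ u → shift σ u ≢ u) →
                         ConnectionSet (σ ∷ [])
  singleton-involution σ σ∘σ≗id σ-fpf = record
    { inverse-closed    = λ { (here refl) → σ , here refl , σ∘σ≗id }
    ; fixed-point-free  = λ { (here refl) → σ-fpf }
    ; neighbours-unique = λ _ → [] ∷ []
    }

  module Translate {S : List Shift} (C : ConnectionSet S) (σ : Shift)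
                   (σ∘σ≗id : ∀ u → shift σ (shift σ u) ≡ u)
                   (S∘σ-fpf : ∀ {s} → s ∈ S → ∀ u → shift s (shift σ u) ≢ u) where
    open ConnectionSet C

    ·-⊕ : ∀ u → map (_⊕ σ) S · u ≡ S · shift σ u
    ·-⊕ u = trans (sym (map-∘ S)) (map-cong (λ s → shift-⊕ s σ u) S)

    ⊕-inverse : ∀ s t → (∀ u → shift t (shift s u) ≡ u) → ∀ u → shift (t ⊕ σ) (shift (s ⊕ σ) u) ≡ u
    ⊕-inverse s t t∘s≗id u = begin
      shift (t ⊕ σ) (shift (s ⊕ σ) u)           ≡⟨ shift-⊕ t σ (shift (s ⊕ σ) u) ⟩
      shift t (shift σ (shift (s ⊕ σ) u))       ≡⟨ cong (shift t ∘ shift σ) (shift-⊕ s σ u) ⟩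
      shift t (shift σ (shift s (shift σ u)))   ≡⟨ cong (shift t) (shift-comm σ s (shift σ u)) ⟩
      shift t (shift s (shift σ (shift σ u)))   ≡⟨ cong (shift t ∘ shift s) (σ∘σ≗id u) ⟩
      shift t (shift s u)                       ≡⟨ t∘s≗id u ⟩
      u                                         ∎
      where open ≡-Reasoning

    translate : ConnectionSet (map (_⊕ σ) S)
    translate = record
      { inverse-closed    = inverse-closed′
      ; fixed-point-free  = fixed-point-free′
      ; neighbours-unique = λ u → subst Unique (sym (·-⊕ u)) (neighbours-unique (shift σ u))
      }
      where
        inverse-closed′ : ∀ {s′} → s′ ∈ map (_⊕ σ) S →
                          ∃[ t′ ] t′ ∈ map (_⊕ σ) S × (∀ u → shift t′ (shift s′ u) ≡ u)
        inverse-closed′ s′∈ with ∈-map⁻ (_⊕ σ) s′∈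
        ... | s , s∈S , refl with inverse-closed s∈S
        ...   | t , t∈S , t∘s≗id = t ⊕ σ , ∈-map⁺ (_⊕ σ) t∈S , ⊕-inverse s t t∘s≗id
        fixed-point-free′ : ∀ {s′} → s′ ∈ map (_⊕ σ) S → ∀ u → shift s′ u ≢ u
        fixed-point-free′ s′∈ u with ∈-map⁻ (_⊕ σ) s′∈
        ... | s , s∈S , refl = λ eq → S∘σ-fpf s∈S u (trans (sym (shift-⊕ s σ u)) eq)

  torusShifts : List Shift
  torusShifts = (1 , 0) ∷ (0 , 1) ∷ (0 , b) ∷ (a , 0) ∷ []

  torusAdj-shifts : ∀ u v → torusAdj (suc a) (suc b) u v ≡ does (v ∈? torusShifts · u)
  torusAdj-shifts (i , j) (p , q) = begin
    (cycAdj (suc a) i p ∧ ⌊ j ≟ᶠ q ⌋) ∨ (⌊ i ≟ᶠ p ⌋ ∧ cycAdj (suc b) j q)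
      ≡⟨ cong₂ _∨_ (cong₂ _∧_ (A.cycAdj-rot i p) (⌊⌋-⇔ (mk⇔ sym sym) (j ≟ᶠ q) (q ≟ᶠ j)))
                   (cong₂ _∧_ (⌊⌋-⇔ (mk⇔ sym sym) (i ≟ᶠ p) (p ≟ᶠ i)) (B.cycAdj-rot j q)) ⟩
    ((p↦1 ∨ p↦a) ∧ q↦0) ∨ (p↦0 ∧ (q↦1 ∨ q↦b))
      ≡⟨ ∨-∧-expand p↦1 p↦a q↦0 p↦0 q↦1 q↦b ⟩
    (p↦1 ∧ q↦0) ∨ ((p↦0 ∧ q↦1) ∨ ((p↦0 ∧ q↦b) ∨ ((p↦a ∧ q↦0) ∨ false)))
      ≡⟨ cong₂ _∨_ (sym (does-≟ₜ p _ q _)) (cong₂ _∨_ (sym (does-≟ₜ p _ q _))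
                   (cong₂ _∨_ (sym (does-≟ₜ p _ q _)) (cong (_∨ false) (sym (does-≟ₜ p _ q _))))) ⟩
    does ((p , q) ∈? torusShifts · (i , j)) ∎
    where
      open ≡-Reasoning
      p↦1 = does (p ≟ᶠ A.rot 1 i)
      p↦a = does (p ≟ᶠ A.rot a i)
      p↦0 = does (p ≟ᶠ i)
      q↦1 = does (q ≟ᶠ B.rot 1 j)
      q↦b = does (q ≟ᶠ B.rot b j)
      q↦0 = does (q ≟ᶠ j)

  torusShifts-connection : 2 ≤ a → 2 ≤ b → ConnectionSet torusShifts
  torusShifts-connection 2≤a 2≤b = record
    { inverse-closed    = λ
        { (here refl)                         → (a , 0) , there (there (there (here refl))) ,
                                                shift-shift (a , 0) (1 , 0) (0 , 0) 1 0 (m≡n⇒m≡1*n+0 (+-comm a 1)) refl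
        ; (there (here refl))                 → (0 , b) , there (there (here refl)) ,
                                                shift-shift (0 , b) (0 , 1) (0 , 0) 0 1 refl (m≡n⇒m≡1*n+0 (+-comm b 1))
        ; (there (there (here refl)))         → (0 , 1) , there (here refl) ,
                                                shift-shift (0 , 1) (0 , b) (0 , 0) 0 1 refl (m≡n⇒m≡1*n+0 refl)
        ; (there (there (there (here refl)))) → (1 , 0) , here refl ,
                                                shift-shift (1 , 0) (a , 0) (0 , 0) 1 0 (m≡n⇒m≡1*n+0 refl) refl
        }
    ; fixed-point-free  = λ
        { (here refl)                         (i , j) → ≢-fst (i₁≢i₀ i)
        ; (there (here refl))                 (i , j) → ≢-snd (B.rot-distinct j (s≤s z≤n) (s≤s (<⇒≤ 2≤b)))
        ; (there (there (here refl)))         (i , j) → ≢-snd (B.rot-distinct j (<⇒≤ 2≤b) ≤-refl)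
        ; (there (there (there (here refl)))) (i , j) → ≢-fst (≢-sym (i₀≢iₐ i))
        }
    ; neighbours-unique = λ { (i , j) →
          (≢-fst (i₁≢i₀ i) ∷ ≢-fst (i₁≢i₀ i) ∷ ≢-fst (≢-sym (A.rot-distinct i 2≤a ≤-refl)) ∷ [])
        ∷ (≢-snd (≢-sym (B.rot-distinct j 2≤b ≤-refl)) ∷ ≢-fst (i₀≢iₐ i) ∷ [])
        ∷ (≢-fst (i₀≢iₐ i) ∷ [])
        ∷ [] ∷ [] }
    }
    where
      i₁≢i₀ : ∀ i → A.rot 1 i ≢ i
      i₁≢i₀ i = A.rot-distinct i (s≤s z≤n) (s≤s (<⇒≤ 2≤a))
      i₀≢iₐ : ∀ i → i ≢ A.rot a i
      i₀≢iₐ i = ≢-sym (A.rot-distinct i (<⇒≤ 2≤a) ≤-refl)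

  factorable-by-cayley : 2 ≤ a → 2 ≤ b → ∀ {S T} → ConnectionSet S → ConnectionSet T →
                         (∀ u → concatMap (T ·_) (S · u) ≡ torusShifts · u) →
                         FactorableTorusMatrix (suc a) (suc b) (torusA (suc a) (suc b))
  factorable-by-cayley 2≤a 2≤b {S} {T} CS CT S+T≡torusShifts = cayley CS , cayley CT , λ u v → begin
    torusA (suc a) (suc b) u v           ≡⟨ cong 𝟙 (torusAdj-shifts u v) ⟩
    A[ cayley torus ] u v                ≡⟨ A-cayley torus u v ⟩
    occ v (torusShifts · u)              ≡⟨ cong (occ v) (S+T≡torusShifts u) ⟨
    occ v (concatMap (T ·_) (S · u))     ≡⟨ cayley-product CS CT u v ⟨
    sumTorus (suc a) (suc b) (λ w → A[ cayley CS ] u w * A[ cayley CT ] w v) ∎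
    where
      open ≡-Reasoning
      torus = torusShifts-connection 2≤a 2≤b

  factorable-by-involution : 2 ≤ a → 2 ≤ b →
                             ∀ σ → (∀ u → shift σ (shift σ u) ≡ u) → (∀ u → shift σ u ≢ u) →
                             (∀ {s} → s ∈ torusShifts → ∀ u → shift s (shift σ u) ≢ u) →
                             FactorableTorusMatrix (suc a) (suc b) (torusA (suc a) (suc b))
  factorable-by-involution 2≤a 2≤b σ σ∘σ≗id σ-fpf torus∘σ-fpf =
    factorable-by-cayley 2≤a 2≤b (singleton-involution σ σ∘σ≗id σ-fpf) translate λ u →
      trans (++-identityʳ _) (trans (·-⊕ (shift σ u)) (cong (torusShifts ·_) (σ∘σ≗id u)))
    where open Translate (torusShifts-connection 2≤a 2≤b) σ σ∘σ≗id torus∘σ-fpf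

factorable-odd : ∀ p q → 1 ≤ p → 1 ≤ q →
                 FactorableTorusMatrix (suc (p + p)) (suc (q + q)) (torusA (suc (p + p)) (suc (q + q)))
factorable-odd p q 1≤p 1≤q =
  factorable-by-cayley (+-mono-≤ 1≤p 1≤p) (+-mono-≤ 1≤q 1≤q)
    (inverse-pair {p} {suc p} {q} {suc q} 1≤p (n<1+n p) (+-suc p p) (+-suc q q))
    (inverse-pair {p} {suc p} {suc q} {q} 1≤p (n<1+n p) (+-suc p p) refl)
    S+T≡torusShifts
  where
    open Torus (p + p) (q + q)
    S+T≡torusShifts : ∀ u → concatMap (((suc p , q) ∷ (p , suc q) ∷ []) ·_)
                                      (((suc p , suc q) ∷ (p , q) ∷ []) · u)
                            ≡ torusShifts · u
    S+T≡torusShifts u =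
      cong₂ _∷_ (shift-shift (suc p , q) (suc p , suc q) (1 , 0) 1 1
                  ([1+n]+[1+n]≡1*[1+[n+n]]+1 p) (m≡n⇒m≡1*n+0 (+-suc q q)) u)
      (cong₂ _∷_ (shift-shift (p , suc q) (suc p , suc q) (0 , 1) 1 1
                   (m≡n⇒m≡1*n+0 (+-suc p p)) ([1+n]+[1+n]≡1*[1+[n+n]]+1 q) u)
      (cong₂ _∷_ (shift-shift (suc p , q) (p , q) (0 , q + q) 1 0 (m≡n⇒m≡1*n+0 refl) refl u)
      (cong₂ _∷_ (shift-shift (p , suc q) (p , q) (p + p , 0) 0 1 refl (m≡n⇒m≡1*n+0 refl) u)
       refl)))

factorable-even-rows : ∀ h n → 2 ≤ h → 3 ≤ n → FactorableTorusMatrix (h + h) n (torusA (h + h) n)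
factorable-even-rows (suc g) (suc b) (s≤s 1≤g) (s≤s 2≤b) =
  factorable-by-involution (+-mono-≤ 1≤g (s≤s z≤n)) 2≤b σ σ∘σ≗id σ-fpf torus∘σ-fpf
  where
    open Torus (g + suc g) b
    σ : Shift
    σ = suc g , 0
    σ∘σ≗id : ∀ u → shift σ (shift σ u) ≡ u
    σ∘σ≗id = shift-shift σ σ (0 , 0) 1 0 (m≡n⇒m≡1*n+0 refl) refl
    h<M : suc g < suc (g + suc g)
    h<M = s≤s (m≤n+m (suc g) g)
    h+1<M : suc (suc g) < suc (g + suc g)
    h+1<M = s≤s (+-monoˡ-≤ (suc g) 1≤g)
    σ-fpf : ∀ u → shift σ u ≢ u
    σ-fpf (i , j) = ≢-fst (A.rot-distinct i (s≤s z≤n) h<M)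
    torus∘σ-fpf : ∀ {s} → s ∈ torusShifts → ∀ u → shift s (shift σ u) ≢ u
    torus∘σ-fpf (here refl)                         (i , j) = ≢-fst (A.rot-distinct i (s≤s z≤n) h+1<M)
    torus∘σ-fpf (there (here refl))                 (i , j) = ≢-fst (A.rot-distinct i (s≤s z≤n) h<M)
    torus∘σ-fpf (there (there (here refl)))         (i , j) = ≢-fst (A.rot-distinct i (s≤s z≤n) h<M)
    torus∘σ-fpf (there (there (there (here refl)))) u@(i , j) eq =
      ≢-fst (A.rot-distinct i 1≤g (s≤s (m≤m+n g (suc g))))
            (trans (sym (shift-shift (g + suc g , 0) σ (g , 0) 1 0 (n+[1+n]+[1+n]≡1*[1+[n+[1+n]]]+n g) refl u)) eq)

factorable-even-columns : ∀ m h → 3 ≤ m → 2 ≤ h → FactorableTorusMatrix m (h + h) (torusA m (h + h))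
factorable-even-columns (suc a) (suc g) (s≤s 2≤a) (s≤s 1≤g) =
  factorable-by-involution 2≤a (+-mono-≤ 1≤g (s≤s z≤n)) σ σ∘σ≗id σ-fpf torus∘σ-fpf
  where
    open Torus a (g + suc g)
    σ : Shift
    σ = 0 , suc g
    σ∘σ≗id : ∀ u → shift σ (shift σ u) ≡ u
    σ∘σ≗id = shift-shift σ σ (0 , 0) 0 1 refl (m≡n⇒m≡1*n+0 refl)
    h<N : suc g < suc (g + suc g)
    h<N = s≤s (m≤n+m (suc g) g)
    h+1<N : suc (suc g) < suc (g + suc g)
    h+1<N = s≤s (+-monoˡ-≤ (suc g) 1≤g)
    σ-fpf : ∀ u → shift σ u ≢ u
    σ-fpf (i , j) = ≢-snd (B.rot-distinct j (s≤s z≤n) h<N)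
    torus∘σ-fpf : ∀ {s} → s ∈ torusShifts → ∀ u → shift s (shift σ u) ≢ u
    torus∘σ-fpf (here refl)                         (i , j) = ≢-fst (A.rot-distinct i (s≤s z≤n) (s≤s (<⇒≤ 2≤a)))
    torus∘σ-fpf (there (here refl))                 (i , j) = ≢-snd (B.rot-distinct j (s≤s z≤n) h+1<N)
    torus∘σ-fpf (there (there (here refl)))         u@(i , j) eq =
      ≢-snd (B.rot-distinct j 1≤g (s≤s (m≤m+n g (suc g))))
            (trans (sym (shift-shift (0 , g + suc g) σ (0 , g) 0 1 refl (n+[1+n]+[1+n]≡1*[1+[n+[1+n]]]+n g) u)) eq)
    torus∘σ-fpf (there (there (there (here refl)))) (i , j) = ≢-fst (A.rot-distinct i (<⇒≤ 2≤a) ≤-refl)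

data EvenOdd : ℕ → Set where
  even : ∀ h → EvenOdd (h + h)
  odd  : ∀ h → EvenOdd (suc (h + h))

evenOdd : ∀ n → EvenOdd n
evenOdd zero    = even 0
evenOdd (suc n) with evenOdd n
... | even h = odd h
... | odd  h = subst EvenOdd (cong suc (+-suc h h)) (even (suc h))

3≤n+n⇒2≤n : ∀ {n} → 3 ≤ n + n → 2 ≤ n
3≤n+n⇒2≤n {suc (suc n)} _ = s≤s (s≤s z≤n)
3≤n+n⇒2≤n {suc zero} (s≤s (s≤s ()))

3≤1+n+n⇒1≤n : ∀ {n} → 3 ≤ suc (n + n) → 1 ≤ n
3≤1+n+n⇒1≤n {suc n} _ = s≤s z≤n
3≤1+n+n⇒1≤n {zero} (s≤s ())

mainTheorem4 : (m n : ℕ) → m ≥ 3 → n ≥ 3 → FactorableTorusMatrix m n (torusA m n)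
mainTheorem4 m n m≥3 n≥3 with evenOdd m | evenOdd n
... | even h | _      = factorable-even-rows h n (3≤n+n⇒2≤n m≥3) n≥3
... | odd _  | even h = factorable-even-columns m h m≥3 (3≤n+n⇒2≤n n≥3)
... | odd p  | odd q  = factorable-odd p q (3≤1+n+n⇒1≤n m≥3) (3≤1+n+n⇒1≤n n≥3)
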